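{- Let $\mathbf{d}_n=(d_1,\dots,d_n)$ be a degree sequence and define $g_n:[n]\to[0,\infty)$ by $$g_n(k)=\frac{k!}{\langle n\rangle_k}\sum_{i_1<\dots<i_k}\prod_{j=1}^k d_{i_j},$$ the sum over all $(i_1,\dots,i_k)\in[n]^k$ with $i_1<\dots<i_k$, and $\langle n\rangle_k=n!/(n-k)!$. Then $$\mathbb{P}(\mathfrak{s}_n(v)>k)=g_n(k)-\frac{k d_v}{n-k+1}\mathbb{P}(\mathfrak{s}_n(v)>k-1),\qquad k\ge2,\ v\in[n].$$
   Context: A degree sequence is $(d_1,\dots,d_n)\in\mathbb{N}_0^n$ with $\sum_j d_j=n$. $F$ is uniform on $\mathfrak{F}(\mathbf{d}_n)=\{f:[n]\to[n]: |f^{ -1}(\{i\})|=d_i\ \forall i\}$. Six-length: $\mathfrak{s}_f(v)=\min\{k\in\mathbb{N}: f^{(k)}(v)\in\{f^{(j)}(v):0\le j\le k-1\}\}$ ($f^{(k)}$ the $k$-fold composition, $f^{(0)}=\mathrm{id}$); $\mathfrak{s}_n(v)=\mathfrak{s}_F(v)$. -}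

module Defs where

open import Data.Nat using (ℕ; zero; suc; _+_; _*_; _∸_; _<_; _≡ᵇ_; _<ᵇ_; _!)
open import Data.Nat.Combinatorics using (_P_)
open import Data.Bool using (Bool; true; false; if_then_else_; _∧_; not)
open import Data.Fin using (Fin; toℕ)
open import Data.Vec using (Vec; []; _∷_; lookup)
open import Data.List using (List; []; _∷_; map; concatMap; filterᵇ; length; allFin; upTo)
open import Data.Nat.ListAction using (sum)
open import Data.Bool.ListAction using (any; all)
open import Data.Integer using (+_)
open import Data.Rational using (ℚ; _/_; 0ℚ)
open import Relation.Binary.PropositionalEquality using (_≡_)

allVecs : (m n : ℕ) → List (Vec (Fin n) m)
allVecs zero    n = [] ∷ []
allVecs (suc m) n = concatMap (λ i → map (i ∷_) (allVecs m n)) (allFin n)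

Map : ℕ → Set
Map n = Vec (Fin n) n

app : ∀ {n} → Map n → Fin n → Fin n
app f i = lookup f i

_=ᶠ_ : ∀ {n} → Fin n → Fin n → Bool
a =ᶠ b = toℕ a ≡ᵇ toℕ b

preimageSize : ∀ {n} → Map n → Fin n → ℕ
preimageSize {n} f i = length (filterᵇ (λ j → app f j =ᶠ i) (allFin n))

hasDegrees : ∀ {n} → (Fin n → ℕ) → Map n → Bool
hasDegrees {n} d f = all (λ i → preimageSize f i ≡ᵇ d i) (allFin n)

𝔉 : ∀ {n} → (Fin n → ℕ) → List (Map n)
𝔉 {n} d = filterᵇ (hasDegrees d) (allVecs n n)

iter : ∀ {n} → Map n → ℕ → Fin n → Fin n
iter f zero    v = v
iter f (suc k) v = app f (iter f k v)

repeatsAt : ∀ {n} → Map n → Fin n → ℕ → Bool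
repeatsAt f v k = any (λ j → iter f k v =ᶠ iter f j v) (upTo k)

search : ∀ {n} → Map n → Fin n → (start fuel : ℕ) → ℕ
search f v start zero       = start
search f v start (suc fuel) =
  if repeatsAt f v start then start else search f v (suc start) fuel

-- The search over k = 1, …, n+1 suffices: by pigeonhole among the n+1
-- values f^(0)(v), …, f^(n)(v) the minimum is at most n.
sixLength : ∀ {n} → Map n → Fin n → ℕ
sixLength {n} f v = search f v 1 (suc n)

-- a / b as a rational (b = 0 never occurs in the uses below; convention a/0 = 0)
frac : ℕ → ℕ → ℚ
frac a zero    = 0ℚ
frac a (suc b) = (+ a) / suc b

probSixGt : ∀ {n} → (Fin n → ℕ) → Fin n → ℕ → ℚ
probSixGt d v k =
  frac (length (filterᵇ (λ f → k <ᵇ sixLength f v) (𝔉 d))) (length (𝔉 d))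

increasing : ∀ {n m} → Vec (Fin n) m → Bool
increasing []            = true
increasing (i ∷ [])      = true
increasing (i ∷ j ∷ is)  = (toℕ i <ᵇ toℕ j) ∧ increasing (j ∷ is)

prodVec : ∀ {n m} → (Fin n → ℕ) → Vec (Fin n) m → ℕ
prodVec d []       = 1
prodVec d (i ∷ is) = d i * prodVec d is

incSum : ∀ {n} → (Fin n → ℕ) → ℕ → ℕ
incSum {n} d k = sum (map (prodVec d) (filterᵇ increasing (allVecs k n)))

g : ∀ {n} → (Fin n → ℕ) → ℕ → ℚ
g {n} d k = frac (k ! * incSum d k) (n P k)

IsDegreeSeq : ∀ {n} → (Fin n → ℕ) → Set
IsDegreeSeq {n} d = sum (map d (allFin n)) ≡ n

-- Write N for the number of maps in 𝔉(d) and A_k for the number of those with 𝔰_f(v) > k. Counting words with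
-- prescribed letter multiplicities, some letters being fixed in place, gives N · ∏ d_i! = n!. Since 𝔰_f(v) > k
-- exactly when v, f v, …, f^k v are distinct, summing over these possible orbits gives
-- A_k · ∏ d_i! = (n − k)! · k! · e_k(d′), where e_k is the k-th elementary symmetric polynomial and d′ is d with
-- d_v replaced by 0. Hence ℙ(𝔰_n(v) > k) = k! e_k(d′) / ⟨n⟩_k, while g_n(k) = k! e_k(d) / ⟨n⟩_k, and the identity
-- follows from e_k(d) = e_k(d′) + d_v e_{k−1}(d′) and ⟨n⟩_k = (n − k + 1) ⟨n⟩_{k−1}.

module Submission where

open import Algebra.Bundles using (CommutativeMonoid)
open import Data.Bool using (Bool; true; false; if_then_else_; _∧_; _∨_; not)
open import Data.Bool.ListAction using (any; all)
open import Data.Bool.Properties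
  using (∧-conicalˡ; ∧-conicalʳ; ∧-comm; ∧-identityʳ; ∧-zeroʳ; ∨-comm; ∨-assoc; ∨-identityʳ)
open import Data.Fin using (Fin; zero; suc; toℕ)
open import Data.Fin.Properties using (toℕ-injective; punchInᵢ≢i; all?; ¬∀⟶∃¬)
import Data.Integer as ℤ
open import Data.Integer.Properties using (pos-*; pos-+)
open import Data.List as List
  using (List; []; _∷_; _++_; upTo; map; concatMap; filterᵇ; length; allFin; tabulate)
open import Data.List.Properties using (map-++; map-∘; upTo-∷ʳ)
open import Data.Maybe using (Maybe; just; nothing; is-just)
import Data.Nat
open import Data.Nat as ℕ
  using (ℕ; zero; suc; _+_; _*_; _∸_; _≤_; _<_; z≤n; s≤s; pred; _!; _≡ᵇ_; _<ᵇ_; _≤ᵇ_;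
         NonZero; ≢-nonZero⁻¹)
open import Data.Nat.Combinatorics.Base using (_P′_; _P_)
open import Data.Nat.Combinatorics.Specification using (nP′k≡n[n∸1P′k∸1]; nP′k≡n!/[n∸k]!; [n∸k]!k!∣n!)
open import Data.Nat.DivMod using (_/_; m/n*n≡m)
open import Data.Nat.Divisibility using (∣-trans; m∣m*n)
open import Data.Nat.ListAction using (sum)
open import Data.Nat.ListAction.Properties using (sum-++)
open import Data.Nat.Properties
  using (+-*-semiring; +-0-commutativeMonoid; *-1-commutativeMonoid; *-commutativeSemigroup; _≤?_; _!≢0;
         +-identityʳ; +-comm; +-suc; *-identityˡ; *-identityʳ; *-zeroʳ; *-comm; *-assoc;
         suc-injective; m+n≡0⇒m≡0; m+n≡0⇒n≡0; *-cancelʳ-≡; m*n≢0; m*n≢0⇒n≢0;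
         0∸n≡0; m≤n⇒m∸n≡0; m∸n+n≡m; m+n∸n≡m; +-∸-assoc;
         ≤-refl; ≤-reflexive; ≤-trans; ≤-antisym; ≤-pred; <⇒≤; <⇒≱; ≰⇒>; n≤1+n; m≤n⇒m≤1+n;
         m<1+n⇒m<n∨m≡n; m≤n⇒m<n∨m≡n; <ᵇ-reflects-<; ≤ᵇ-reflects-≤)
open import Data.Nat.Tactic.RingSolver using (solve-∀)
open import Data.Product using (_,_)
import Data.Rational
open import Data.Rational as ℚ using (toℚᵘ; _-_)
open import Data.Rational.Properties
  using (toℚᵘ-injective; toℚᵘ-fromℚᵘ; fromℚᵘ-cong; toℚᵘ-homo-+; toℚᵘ-homo-*; +-0-group)
open import Data.Rational.Unnormalised as ℚᵘ using (mkℚᵘ; *≡*)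
import Data.Rational.Unnormalised.Properties as ℚᵘ
open import Data.Sum using (inj₁; inj₂)
open import Data.Vec using (Vec; []; _∷_; lookup; _∷ʳ_; head; tail)
open import Data.Vec.Properties using (∷-injectiveˡ; ∷-injectiveʳ; ≡-dec)
import Data.Vec.Functional as Vector
open import Function using (_∘_; id)
open import Relation.Binary.PropositionalEquality
  using (_≡_; _≢_; refl; sym; trans; cong; cong₂; subst; module ≡-Reasoning)
open import Relation.Nullary using (Dec; yes; no; Reflects; ofʸ; ofⁿ; map′; proof; contradiction)
open import Relation.Nullary.Decidable using (dec-true; dec-false)
open import Relation.Nullary.Reflects using (det)

open import Algebra.Properties.CommutativeSemigroup *-commutativeSemigroup
  using () renaming (x∙yz≈y∙xz to x*yz≡y*xz; xy∙z≈y∙xz to xy*z≡y*xz)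
open import Algebra.Properties.Group +-0-group using (//-rightDividesʳ)
open import Algebra.Properties.Semiring.Sum +-*-semiring
  using (sum-syntax; sum-cong-≗; sum-replicate-zero; ∑-comm; ∑-distrib-+; *-distribˡ-sum; *-distribʳ-sum)
  renaming (sum to ∑)
open import Algebra.Properties.CommutativeMonoid.Sum *-1-commutativeMonoid
  using () renaming (sum to ∏; sum-cong-≗ to ∏-cong; sum-replicate-zero to ∏-const-1)

open import Defs

module _ {a ℓ} (M : CommutativeMonoid a ℓ) where
  open CommutativeMonoid M using (Carrier; _≈_; _∙_; ∙-cong; ∙-congˡ; assoc; setoid)
    renaming (sym to ≈-sym)
  open import Algebra.Properties.CommutativeMonoid.Sum M using (sum-remove; sum-cong-≋)
    renaming (sum to ∑ᴹ)
  open import Relation.Binary.Reasoning.Setoid setoid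

  sum-update : ∀ {n} {g h : Fin n → Carrier} (i : Fin n) (x y : Carrier) →
               (∀ j → j ≢ i → g j ≈ h j) → x ∙ g i ≈ y ∙ h i → x ∙ ∑ᴹ g ≈ y ∙ ∑ᴹ h
  sum-update {suc n} {g} {h} i x y off at = begin
    x ∙ ∑ᴹ g                          ≈⟨ ∙-congˡ (sum-remove {i = i} g) ⟩
    x ∙ (g i ∙ ∑ᴹ (removeAt g i))     ≈⟨ ≈-sym (assoc x (g i) _) ⟩
    (x ∙ g i) ∙ ∑ᴹ (removeAt g i)     ≈⟨ ∙-cong at (sum-cong-≋ λ j → off _ (punchInᵢ≢i i j)) ⟩
    (y ∙ h i) ∙ ∑ᴹ (removeAt h i)     ≈⟨ assoc y (h i) _ ⟩
    y ∙ (h i ∙ ∑ᴹ (removeAt h i))     ≈⟨ ∙-congˡ (≈-sym (sum-remove {i = i} h)) ⟩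
    y ∙ ∑ᴹ h                          ∎
    where open Vector using (removeAt)

∑-update : ∀ {n} {g h : Fin n → ℕ} (i : Fin n) (x y : ℕ) →
           (∀ j → j ≢ i → g j ≡ h j) → x + g i ≡ y + h i → x + ∑ g ≡ y + ∑ h
∑-update = sum-update +-0-commutativeMonoid

∏-update : ∀ {n} {g h : Fin n → ℕ} (i : Fin n) (x y : ℕ) →
           (∀ j → j ≢ i → g j ≡ h j) → x * g i ≡ y * h i → x * ∏ g ≡ y * ∏ h
∏-update = sum-update *-1-commutativeMonoid

𝟙 : Bool → ℕ
𝟙 true  = 1
𝟙 false = 0

𝟙-∧ : ∀ a b → 𝟙 (a ∧ b) ≡ 𝟙 a * 𝟙 b
𝟙-∧ true  b = sym (+-identityʳ (𝟙 b))
𝟙-∧ false b = refl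

𝟙-guard : ∀ b {y z} → (b ≡ true → y ≡ z) → 𝟙 b * y ≡ 𝟙 b * z
𝟙-guard true  y≡z = cong (1 *_) (y≡z refl)
𝟙-guard false _   = refl

-- Decides equality through toℕ, so that its boolean is _=ᶠ_ on the nose.
_≟ᶠ_ : ∀ {n} (a b : Fin n) → Dec (a ≡ b)
a ≟ᶠ b = map′ toℕ-injective (cong toℕ) (toℕ a ℕ.≟ toℕ b)

=ᶠ-reflects : ∀ {n} (a b : Fin n) → Reflects (a ≡ b) (a =ᶠ b)
=ᶠ-reflects a b = proof (a ≟ᶠ b)

=ᶠ-refl : ∀ {n} (a : Fin n) → (a =ᶠ a) ≡ true
=ᶠ-refl a = dec-true (a ≟ᶠ a) refl

=ᶠ-≢ : ∀ {n} {a b : Fin n} → a ≢ b → (a =ᶠ b) ≡ false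
=ᶠ-≢ {a = a} {b} = dec-false (a ≟ᶠ b)

=ᶠ-sym : ∀ {n} (a b : Fin n) → (a =ᶠ b) ≡ (b =ᶠ a)
=ᶠ-sym a b with a =ᶠ b | =ᶠ-reflects a b
... | true  | ofʸ refl = sym (=ᶠ-refl a)
... | false | ofⁿ a≢b  = sym (=ᶠ-≢ (a≢b ∘ sym))

∑-single : ∀ {n} {f : Fin n → ℕ} j → (∀ i → i ≢ j → f i ≡ 0) → ∑ f ≡ f j
∑-single {n} {f} j off = begin
  ∑ f                         ≡⟨ ∑-update j 0 (f j) off (+-comm 0 (f j)) ⟩
  f j + ∑[ i < n ] 0          ≡⟨ cong (f j +_) (sum-replicate-zero n) ⟩
  f j + 0                     ≡⟨ +-identityʳ (f j) ⟩
  f j                         ∎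
  where open ≡-Reasoning

∑-select : ∀ {n} j (f : Fin n → ℕ) → ∑[ i < n ] (𝟙 (i =ᶠ j) * f i) ≡ f j
∑-select j f = trans (∑-single j λ i i≢j → cong (λ b → 𝟙 b * f i) (=ᶠ-≢ i≢j))
                     (trans (cong (λ b → 𝟙 b * f j) (=ᶠ-refl j)) (+-identityʳ (f j)))

∑≡0⇒≡0 : ∀ {n} (c : Fin n → ℕ) → ∑ c ≡ 0 → ∀ j → c j ≡ 0
∑≡0⇒≡0 c ∑c≡0 zero    = m+n≡0⇒m≡0 (c zero) ∑c≡0
∑≡0⇒≡0 c ∑c≡0 (suc j) = ∑≡0⇒≡0 (c ∘ suc) (m+n≡0⇒n≡0 (c zero) ∑c≡0) j

∏-zero : ∀ {n} {g : Fin n → ℕ} i → g i ≡ 0 → ∏ g ≡ 0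
∏-zero {g = g} i gᵢ≡0 =
  trans (sym (*-identityˡ (∏ g))) (∏-update i 1 0 (λ _ _ → refl) (trans (*-identityˡ (g i)) gᵢ≡0))

∑ⱽ : ∀ {n} k → (Vec (Fin n) k → ℕ) → ℕ
∑ⱽ     zero    h = h []
∑ⱽ {n} (suc k) h = ∑[ i < n ] ∑ⱽ k (λ x → h (i ∷ x))

∑ⱽ-cong : ∀ {n} k {h h′ : Vec (Fin n) k → ℕ} → (∀ x → h x ≡ h′ x) → ∑ⱽ k h ≡ ∑ⱽ k h′
∑ⱽ-cong zero    h≗h′ = h≗h′ []
∑ⱽ-cong (suc k) h≗h′ = sum-cong-≗ λ i → ∑ⱽ-cong k λ x → h≗h′ (i ∷ x)

*-distribˡ-∑ⱽ : ∀ {n} k c (h : Vec (Fin n) k → ℕ) → c * ∑ⱽ k h ≡ ∑ⱽ k (λ x → c * h x)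
*-distribˡ-∑ⱽ zero    c h = refl
*-distribˡ-∑ⱽ (suc k) c h =
  trans (*-distribˡ-sum c (λ i → ∑ⱽ k (λ x → h (i ∷ x))))
        (sum-cong-≗ λ i → *-distribˡ-∑ⱽ k c (λ x → h (i ∷ x)))

∑ⱽ-∑-comm : ∀ {n m} k (h : Fin m → Vec (Fin n) k → ℕ) →
            ∑ⱽ k (λ x → ∑[ i < m ] h i x) ≡ ∑[ i < m ] ∑ⱽ k (h i)
∑ⱽ-∑-comm zero    h = refl
∑ⱽ-∑-comm (suc k) h =
  trans (sum-cong-≗ λ j → ∑ⱽ-∑-comm k λ i x → h i (j ∷ x))
        (∑-comm λ j i → ∑ⱽ k (λ x → h i (j ∷ x)))

∑ⱽ-comm : ∀ {n} k l (h : Vec (Fin n) k → Vec (Fin n) l → ℕ) →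
          ∑ⱽ k (λ x → ∑ⱽ l (h x)) ≡ ∑ⱽ l (λ y → ∑ⱽ k (λ x → h x y))
∑ⱽ-comm zero    l h = refl
∑ⱽ-comm (suc k) l h =
  trans (sum-cong-≗ λ i → ∑ⱽ-comm k l λ x → h (i ∷ x))
        (sym (∑ⱽ-∑-comm l λ i y → ∑ⱽ k (λ x → h (i ∷ x) y)))

∑ⱽ-single : ∀ {n} k {h : Vec (Fin n) k → ℕ} y → (∀ x → x ≢ y → h x ≡ 0) → ∑ⱽ k h ≡ h y
∑ⱽ-single zero    []      off = refl
∑ⱽ-single (suc k) (b ∷ y) off =
  trans (∑-single b λ i i≢b → trans (∑ⱽ-single k y λ x _ → off (i ∷ x) (i≢b ∘ ∷-injectiveˡ))
                                     (off (i ∷ y) (i≢b ∘ ∷-injectiveˡ)))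
        (∑ⱽ-single k y λ x x≢y → off (b ∷ x) (x≢y ∘ ∷-injectiveʳ))

sum-map-concatMap : ∀ {A B : Set} (g : A → List B) (h : B → ℕ) xs →
                    sum (map h (concatMap g xs)) ≡ sum (map (λ x → sum (map h (g x))) xs)
sum-map-concatMap g h []       = refl
sum-map-concatMap g h (x ∷ xs) = begin
  sum (map h (g x ++ concatMap g xs))               ≡⟨ cong sum (map-++ h (g x) _) ⟩
  sum (map h (g x) ++ map h (concatMap g xs))       ≡⟨ sum-++ (map h (g x)) _ ⟩
  sum (map h (g x)) + sum (map h (concatMap g xs))  ≡⟨ cong (_ +_) (sum-map-concatMap g h xs) ⟩
  sum (map h (g x)) + _                             ∎
  where open ≡-Reasoning

sum-map-tabulate : ∀ {A : Set} {n} (g : Fin n → A) (h : A → ℕ) →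
                   sum (map h (tabulate g)) ≡ ∑[ i < n ] h (g i)
sum-map-tabulate {n = zero}  g h = refl
sum-map-tabulate {n = suc n} g h = cong (h (g zero) +_) (sum-map-tabulate (g ∘ suc) h)

sum-map-allVecs : ∀ k n (h : Vec (Fin n) k → ℕ) → sum (map h (allVecs k n)) ≡ ∑ⱽ k h
sum-map-allVecs zero    n h = +-identityʳ (h [])
sum-map-allVecs (suc k) n h = begin
  sum (map h (concatMap (λ i → map (i ∷_) (allVecs k n)) (allFin n)))
    ≡⟨ sum-map-concatMap _ h (allFin n) ⟩
  sum (map (λ i → sum (map h (map (i ∷_) (allVecs k n)))) (allFin n))
    ≡⟨ sum-map-tabulate id (λ i → sum (map h (map (i ∷_) (allVecs k n)))) ⟩
  ∑[ i < n ] sum (map h (map (i ∷_) (allVecs k n)))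
    ≡⟨ sum-cong-≗ (λ i → trans (cong sum (sym (map-∘ (allVecs k n))))
                               (sum-map-allVecs k n (λ x → h (i ∷ x)))) ⟩
  ∑ⱽ (suc k) h ∎
  where open ≡-Reasoning

sum-map-filterᵇ : ∀ {A : Set} (p : A → Bool) (h : A → ℕ) xs →
                  sum (map h (filterᵇ p xs)) ≡ sum (map (λ x → 𝟙 (p x) * h x) xs)
sum-map-filterᵇ p h []       = refl
sum-map-filterᵇ p h (x ∷ xs) with p x
... | true  = cong₂ _+_ (sym (+-identityʳ (h x))) (sum-map-filterᵇ p h xs)
... | false = sum-map-filterᵇ p h xs

length-filterᵇ : ∀ {A : Set} (p : A → Bool) xs → length (filterᵇ p xs) ≡ sum (map (𝟙 ∘ p) xs)
length-filterᵇ p []       = refl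
length-filterᵇ p (x ∷ xs) with p x
... | true  = cong suc (length-filterᵇ p xs)
... | false = length-filterᵇ p xs

𝟙-all-tabulate : ∀ {A : Set} {n} (p : A → Bool) (g : Fin n → A) →
                 𝟙 (all p (tabulate g)) ≡ ∏ (λ i → 𝟙 (p (g i)))
𝟙-all-tabulate {n = zero}  p g = refl
𝟙-all-tabulate {n = suc n} p g =
  trans (𝟙-∧ (p (g zero)) _) (cong (𝟙 (p (g zero)) *_) (𝟙-all-tabulate p (g ∘ suc)))

P′-zero : ∀ {c u} → c < u → c P′ u ≡ 0
P′-zero {c} {suc u} (s≤s c≤u) = cong (_* (c P′ u)) (m≤n⇒m∸n≡0 c≤u)

*-pred-P′ : ∀ c u → c * (pred c P′ u) ≡ c P′ suc u
*-pred-P′ zero    u = sym (cong (_* (0 P′ u)) (0∸n≡0 u))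
*-pred-P′ (suc c) u = sym (nP′k≡n[n∸1P′k∸1] (suc c) (suc u))

-- Since _P′_ subtracts truncatedly, either u ≤ c pointwise or some factor c i P′ u i is 0.
∏P′-*-∑∸ : ∀ {n} (c u : Fin n → ℕ) →
           ∏ (λ i → c i P′ u i) * ∑ (λ i → c i ∸ u i) ≡ ∏ (λ i → c i P′ u i) * (∑ c ∸ ∑ u)
∏P′-*-∑∸ {n} c u with all? (λ i → u i ≤? c i)
... | yes u≤c = cong (∏ (λ i → c i P′ u i) *_) (begin
  ∑ (λ i → c i ∸ u i)              ≡⟨ sym (m+n∸n≡m _ (∑ u)) ⟩
  ∑ (λ i → c i ∸ u i) + ∑ u ∸ ∑ u  ≡⟨ cong (_∸ ∑ u) (sym (∑-distrib-+ (λ i → c i ∸ u i) u)) ⟩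
  ∑ (λ i → c i ∸ u i + u i) ∸ ∑ u  ≡⟨ cong (_∸ ∑ u) (sum-cong-≗ λ i → m∸n+n≡m (u≤c i)) ⟩
  ∑ c ∸ ∑ u                        ∎)
  where open ≡-Reasoning
... | no u≰c with ¬∀⟶∃¬ n _ (λ i → u i ≤? c i) u≰c
...   | i , uᵢ≰cᵢ rewrite ∏-zero {g = λ i → c i P′ u i} i (P′-zero (≰⇒> uᵢ≰cᵢ)) = refl

P≡P′ : ∀ {n k} → k ≤ n → n P k ≡ n P′ k
P≡P′ {n} {k} k≤n = cong (if_then n P′ k else 0) (det (≤ᵇ-reflects-≤ k n) (ofʸ k≤n))

P*[n∸k]!≡n! : ∀ {n k} → k ≤ n → (n P k) * (n ∸ k) ! ≡ n !
P*[n∸k]!≡n! {n} {k} k≤n = begin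
  (n P k) * (n ∸ k) !
    ≡⟨ cong (λ z → z * (n ∸ k) !) (trans (P≡P′ k≤n) (nP′k≡n!/[n∸k]! k≤n)) ⟩
  (n ! / (n ∸ k) !) {{(n ∸ k) !≢0}} * (n ∸ k) !
    ≡⟨ m/n*n≡m {{(n ∸ k) !≢0}} (∣-trans (m∣m*n (k !)) ([n∸k]!k!∣n! k≤n)) ⟩
  n ! ∎
  where open ≡-Reasoning

P≢0 : ∀ {n k} → k ≤ n → n P k ≢ 0
P≢0 {n} {k} k≤n nPk≡0 =
  ≢-nonZero⁻¹ (n !) {{n !≢0}} (trans (sym (P*[n∸k]!≡n! k≤n)) (cong (λ z → z * (n ∸ k) !) nPk≡0))

P-suc : ∀ {n k} → suc k ≤ n → n P suc k ≡ suc (n ∸ suc k) * (n P k)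
P-suc {n} {k} k<n = trans (P≡P′ k<n) (cong₂ _*_ (+-∸-assoc 1 k<n) (sym (P≡P′ (<⇒≤ k<n))))

-- Counting words with prescribed letter multiplicities

occurrences : ∀ {n m} → Vec (Fin n) m → Fin n → ℕ
occurrences x j = ∑ λ p → 𝟙 (lookup x p =ᶠ j)

fits : ∀ {n m} → (Fin n → ℕ) → Vec (Fin n) m → ℕ
fits c x = ∏ λ j → 𝟙 (occurrences x j ≡ᵇ c j)

removeOne : ∀ {n} → (Fin n → ℕ) → Fin n → Fin n → ℕ
removeOne c i j = if j =ᶠ i then pred (c j) else c j

removeOne-≢ : ∀ {n} (c : Fin n → ℕ) {i j} → j ≢ i → removeOne c i j ≡ c j
removeOne-≢ c j≢i rewrite =ᶠ-≢ j≢i = refl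

removeOne-self : ∀ {n} (c : Fin n → ℕ) i → removeOne c i i ≡ pred (c i)
removeOne-self c i rewrite =ᶠ-refl i = refl

fits-∷ : ∀ {n m} (c : Fin n → ℕ) i (x : Vec (Fin n) m) →
         fits c (i ∷ x) ≡ 𝟙 (0 <ᵇ c i) * fits (removeOne c i) x
fits-∷ c i x = trans (sym (*-identityˡ (fits c (i ∷ x)))) (∏-update i 1 (𝟙 (0 <ᵇ c i)) off at)
  where
  off : ∀ j → j ≢ i →
        𝟙 (𝟙 (i =ᶠ j) + occurrences x j ≡ᵇ c j) ≡ 𝟙 (occurrences x j ≡ᵇ removeOne c i j)
  off j j≢i rewrite =ᶠ-≢ (j≢i ∘ sym) | removeOne-≢ c j≢i = refl
  at : 1 * 𝟙 (𝟙 (i =ᶠ i) + occurrences x i ≡ᵇ c i) ≡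
       𝟙 (0 <ᵇ c i) * 𝟙 (occurrences x i ≡ᵇ removeOne c i i)
  at rewrite =ᶠ-refl i with c i
  ... | zero  = refl
  ... | suc _ = refl

∑-removeOne : ∀ {n} (c : Fin n → ℕ) {i c′} → c i ≡ suc c′ → ∑ c ≡ suc (∑ (removeOne c i))
∑-removeOne c {i} cᵢ≡1+c′ =
  ∑-update i 0 1 (λ j j≢i → sym (removeOne-≢ c j≢i))
           (trans cᵢ≡1+c′ (cong suc (sym (trans (removeOne-self c i) (cong pred cᵢ≡1+c′)))))

∏!-removeOne : ∀ {n} (c : Fin n → ℕ) i →
               𝟙 (0 <ᵇ c i) * ∏ (λ j → c j !) ≡ c i * ∏ (λ j → removeOne c i j !)
∏!-removeOne c i = ∏-update i (𝟙 (0 <ᵇ c i)) (c i) (λ j j≢i → cong _! (sym (removeOne-≢ c j≢i))) at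
  where
  at : 𝟙 (0 <ᵇ c i) * c i ! ≡ c i * removeOne c i i !
  at rewrite removeOne-self c i with c i
  ... | zero  = refl
  ... | suc k = *-identityˡ (suc k !)

∏P′-removeOne : ∀ {n} (c u : Fin n → ℕ) i →
                c i * ∏ (λ j → removeOne c i j P′ u j) ≡ (c i ∸ u i) * ∏ (λ j → c j P′ u j)
∏P′-removeOne c u i =
  ∏-update i (c i) (c i ∸ u i) (λ j j≢i → cong (_P′ u j) (removeOne-≢ c j≢i))
           (trans (cong (λ z → c i * (z P′ u i)) (removeOne-self c i)) (*-pred-P′ (c i) (u i)))

∏P′-removeOne-+𝟙 : ∀ {n} (c u : Fin n → ℕ) i →
                         c i * ∏ (λ j → removeOne c i j P′ u j) ≡
                         1 * ∏ (λ j → c j P′ (𝟙 (j =ᶠ i) + u j))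
∏P′-removeOne-+𝟙 c u i = ∏-update i (c i) 1 off at
  where
  off : ∀ j → j ≢ i → removeOne c i j P′ u j ≡ c j P′ (𝟙 (j =ᶠ i) + u j)
  off j j≢i rewrite =ᶠ-≢ j≢i = refl
  at : c i * (removeOne c i i P′ u i) ≡ 1 * (c i P′ (𝟙 (i =ᶠ i) + u i))
  at rewrite removeOne-self c i | =ᶠ-refl i = trans (*-pred-P′ (c i) (u i)) (sym (*-identityˡ _))

∑-removeOne-P′ : ∀ {n} (c u : Fin n → ℕ) →
                 ∑[ i < n ] (c i * ∏ (λ j → removeOne c i j P′ u j)) ≡
                 ∏ (λ j → c j P′ u j) * (∑ c ∸ ∑ u)
∑-removeOne-P′ {n} c u = begin
  ∑[ i < n ] (c i * ∏ (λ j → removeOne c i j P′ u j))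
    ≡⟨ sum-cong-≗ (λ i → trans (∏P′-removeOne c u i) (*-comm _ Π)) ⟩
  ∑[ i < n ] (Π * (c i ∸ u i))
    ≡⟨ sym (*-distribˡ-sum Π (λ i → c i ∸ u i)) ⟩
  Π * ∑ (λ i → c i ∸ u i)
    ≡⟨ ∏P′-*-∑∸ c u ⟩
  Π * (∑ c ∸ ∑ u) ∎
  where
  open ≡-Reasoning
  Π = ∏ (λ j → c j P′ u j)

-- C p = just j prescribes the letter j at position p; C p = nothing leaves it free.
Constraint : ℕ → ℕ → Set
Constraint m n = Fin m → Maybe (Fin n)

meets : ∀ {n} → Maybe (Fin n) → Fin n → ℕ
meets nothing  i = 1
meets (just j) i = 𝟙 (i =ᶠ j)

pointsTo : ∀ {n} → Maybe (Fin n) → Fin n → ℕ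
pointsTo nothing  i = 0
pointsTo (just j) i = 𝟙 (i =ᶠ j)

satisfies : ∀ {m n} → Constraint m n → Vec (Fin n) m → ℕ
satisfies C x = ∏ λ p → meets (C p) (lookup x p)

#constrained : ∀ {m n} → Constraint m n → ℕ
#constrained C = ∑ λ p → 𝟙 (is-just (C p))

#constrainedTo : ∀ {m n} → Constraint m n → Fin n → ℕ
#constrainedTo C i = ∑ λ p → pointsTo (C p) i

#constrained-≤ : ∀ {m n} (C : Constraint m n) → #constrained C ≤ m
#constrained-≤ {zero}  C = z≤n
#constrained-≤ {suc m} C with C zero
... | nothing = m≤n⇒m≤1+n (#constrained-≤ (C ∘ suc))
... | just _  = s≤s (#constrained-≤ (C ∘ suc))

∑-#constrainedTo : ∀ {m n} (C : Constraint m n) → ∑ (#constrainedTo C) ≡ #constrained C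
∑-#constrainedTo {n = n} C = trans (∑-comm (λ i p → pointsTo (C p) i)) (sum-cong-≗ (∑-pointsTo ∘ C))
  where
  ∑-pointsTo : ∀ x → ∑ (pointsTo x) ≡ 𝟙 (is-just x)
  ∑-pointsTo nothing  = sum-replicate-zero n
  ∑-pointsTo (just j) = trans (sum-cong-≗ λ i → sym (*-identityʳ (𝟙 (i =ᶠ j)))) (∑-select j (λ _ → 1))

#fillings : ∀ {n} m → (Fin n → ℕ) → Constraint m n → ℕ
#fillings m c C = ∑ⱽ m λ x → fits c x * satisfies C x

#fillings-suc : ∀ {n} m (c : Fin n → ℕ) (C : Constraint (suc m) n) →
                #fillings (suc m) c C ≡
                ∑[ i < n ] (meets (C zero) i * (𝟙 (0 <ᵇ c i) * #fillings m (removeOne c i) (C ∘ suc)))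
#fillings-suc m c C = sum-cong-≗ λ i → begin
  ∑ⱽ m (λ x → fits c (i ∷ x) * (meets (C zero) i * satisfies (C ∘ suc) x))
    ≡⟨ ∑ⱽ-cong m (λ x → trans (cong (_* _) (fits-∷ c i x))
                   (shuffle (𝟙 (0 <ᵇ c i)) (fits (removeOne c i) x) (meets (C zero) i) (satisfies (C ∘ suc) x))) ⟩
  ∑ⱽ m (λ x → meets (C zero) i * (𝟙 (0 <ᵇ c i) * (fits (removeOne c i) x * satisfies (C ∘ suc) x)))
    ≡⟨ sym (*-distribˡ-∑ⱽ m (meets (C zero) i) _) ⟩
  meets (C zero) i * ∑ⱽ m (λ x → 𝟙 (0 <ᵇ c i) * (fits (removeOne c i) x * satisfies (C ∘ suc) x))
    ≡⟨ cong (meets (C zero) i *_) (sym (*-distribˡ-∑ⱽ m (𝟙 (0 <ᵇ c i)) _)) ⟩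
  meets (C zero) i * (𝟙 (0 <ᵇ c i) * #fillings m (removeOne c i) (C ∘ suc)) ∎
  where
  open ≡-Reasoning
  shuffle : ∀ a b c d → a * b * (c * d) ≡ c * (a * (b * d))
  shuffle = solve-∀

fillings-step : ∀ {n m} (c : Fin n → ℕ) (C : Constraint (suc m) n) (R : (Fin n → ℕ) → ℕ) →
                ∑ c ≡ suc m →
                (∀ c′ → ∑ c′ ≡ m → #fillings m c′ (C ∘ suc) * ∏ (λ j → c′ j !) ≡ R c′) →
                #fillings (suc m) c C * ∏ (λ j → c j !) ≡ ∑[ i < n ] (meets (C zero) i * (c i * R (removeOne c i)))
fillings-step {n} {m} c C R ∑c≡1+m IH = begin
  #fillings (suc m) c C * ∏ (λ j → c j !)
    ≡⟨ cong (_* ∏ (λ j → c j !)) (#fillings-suc m c C) ⟩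
  ∑[ i < n ] (meets (C zero) i * (𝟙 (0 <ᵇ c i) * F i)) * ∏ (λ j → c j !)
    ≡⟨ *-distribʳ-sum (∏ (λ j → c j !)) (λ i → meets (C zero) i * (𝟙 (0 <ᵇ c i) * F i)) ⟩
  ∑[ i < n ] (meets (C zero) i * (𝟙 (0 <ᵇ c i) * F i) * ∏ (λ j → c j !))
    ≡⟨ sum-cong-≗ (λ i → trans (*-assoc (meets (C zero) i) _ _) (cong (meets (C zero) i *_) (remove i))) ⟩
  ∑[ i < n ] (meets (C zero) i * (c i * R (removeOne c i))) ∎
  where
  open ≡-Reasoning
  F = λ i → #fillings m (removeOne c i) (C ∘ suc)
  apply-IH : ∀ i {k} → c i ≡ k → k * (F i * ∏ (λ j → removeOne c i j !)) ≡ k * R (removeOne c i)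
  apply-IH i {zero}  _       = refl
  apply-IH i {suc k} cᵢ≡1+k =
    cong (suc k *_) (IH _ (suc-injective (trans (sym (∑-removeOne c cᵢ≡1+k)) ∑c≡1+m)))
  remove : ∀ i → 𝟙 (0 <ᵇ c i) * F i * ∏ (λ j → c j !) ≡ c i * R (removeOne c i)
  remove i = begin
    𝟙 (0 <ᵇ c i) * F i * ∏ (λ j → c j !)        ≡⟨ xy*z≡y*xz (𝟙 (0 <ᵇ c i)) (F i) _ ⟩
    F i * (𝟙 (0 <ᵇ c i) * ∏ (λ j → c j !))      ≡⟨ cong (F i *_) (∏!-removeOne c i) ⟩
    F i * (c i * ∏ (λ j → removeOne c i j !))    ≡⟨ x*yz≡y*xz (F i) (c i) _ ⟩
    c i * (F i * ∏ (λ j → removeOne c i j !))    ≡⟨ apply-IH i refl ⟩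
    c i * R (removeOne c i)                      ∎

∑-removeOne-unconstrained : ∀ {n} m J (c u : Fin n → ℕ) → ∑ c ≡ suc m → ∑ u ≡ J → J ≤ m →
                            ∑[ i < n ] (1 * (c i * ((m ∸ J) ! * ∏ (λ j → removeOne c i j P′ u j)))) ≡
                            (suc m ∸ J) ! * ∏ (λ j → c j P′ u j)
∑-removeOne-unconstrained {n} m J c u ∑c≡1+m ∑u≡J J≤m = begin
  ∑[ i < n ] (1 * (c i * (K * ∏ (λ j → removeOne c i j P′ u j))))
    ≡⟨ sum-cong-≗ (λ i → trans (*-identityˡ _) (x*yz≡y*xz (c i) K _)) ⟩
  ∑[ i < n ] (K * (c i * ∏ (λ j → removeOne c i j P′ u j)))
    ≡⟨ sym (*-distribˡ-sum K (λ i → c i * ∏ (λ j → removeOne c i j P′ u j))) ⟩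
  K * ∑[ i < n ] (c i * ∏ (λ j → removeOne c i j P′ u j))
    ≡⟨ cong (K *_) (∑-removeOne-P′ c u) ⟩
  K * (Π * (∑ c ∸ ∑ u))
    ≡⟨ cong₂ (λ a b → K * (Π * (a ∸ b))) ∑c≡1+m ∑u≡J ⟩
  K * (Π * (suc m ∸ J))
    ≡⟨ cong (λ z → K * (Π * z)) (+-∸-assoc 1 J≤m) ⟩
  K * (Π * suc (m ∸ J))
    ≡⟨ factorial-step K Π (m ∸ J) ⟩
  suc (m ∸ J) * K * Π
    ≡⟨ cong (λ z → z ! * Π) (sym (+-∸-assoc 1 J≤m)) ⟩
  (suc m ∸ J) ! * Π ∎
  where
  open ≡-Reasoning
  K = (m ∸ J) !
  Π = ∏ (λ j → c j P′ u j)
  factorial-step : ∀ a b c → a * (b * suc c) ≡ suc c * a * b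
  factorial-step = solve-∀

∑-removeOne-constrained : ∀ {n} K (c u : Fin n → ℕ) j →
                          ∑[ i < n ] (𝟙 (i =ᶠ j) * (c i * (K * ∏ (λ l → removeOne c i l P′ u l)))) ≡
                          K * ∏ (λ l → c l P′ (𝟙 (l =ᶠ j) + u l))
∑-removeOne-constrained K c u j = begin
  ∑[ i < _ ] (𝟙 (i =ᶠ j) * (c i * (K * ∏ (λ l → removeOne c i l P′ u l))))
    ≡⟨ ∑-select j (λ i → c i * (K * ∏ (λ l → removeOne c i l P′ u l))) ⟩
  c j * (K * ∏ (λ l → removeOne c j l P′ u l))
    ≡⟨ x*yz≡y*xz (c j) K _ ⟩
  K * (c j * ∏ (λ l → removeOne c j l P′ u l))
    ≡⟨ cong (K *_) (trans (∏P′-removeOne-+𝟙 c u j) (*-identityˡ _)) ⟩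
  K * ∏ (λ l → c l P′ (𝟙 (l =ᶠ j) + u l)) ∎
  where
  open ≡-Reasoning

fillings-formula : ∀ {n} m (c : Fin n → ℕ) (C : Constraint m n) → ∑ c ≡ m →
                   #fillings m c C * ∏ (λ i → c i !) ≡
                   (m ∸ #constrained C) ! * ∏ (λ i → c i P′ #constrainedTo C i)
fillings-formula {n} zero c C ∑c≡0 = begin
  fits c [] * 1 * ∏ (λ i → c i !)
    ≡⟨ cong₂ (λ a b → a * 1 * b) (∏-cong λ j → cong (λ z → 𝟙 (0 ≡ᵇ z)) (cⱼ≡0 j))
                                 (∏-cong {n} λ j → cong _! (cⱼ≡0 j)) ⟩
  ∏ {n} (λ _ → 1) * 1 * ∏ {n} (λ _ → 1)
    ≡⟨ cong₂ (λ a b → a * 1 * b) (∏-const-1 n) (∏-const-1 n) ⟩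
  1
    ≡⟨ cong (1 *_) (sym (∏-const-1 n)) ⟩
  1 * ∏ {n} (λ _ → 1) ∎
  where
  open ≡-Reasoning
  cⱼ≡0 = ∑≡0⇒≡0 c ∑c≡0
fillings-formula {n} (suc m) c C ∑c≡1+m
  with C zero
     | fillings-step c C (λ c′ → (m ∸ #constrained (C ∘ suc)) ! *
                                  ∏ (λ i → c′ i P′ #constrainedTo (C ∘ suc) i))
         ∑c≡1+m (λ c′ → fillings-formula m c′ (C ∘ suc))
... | nothing | step =
  trans step (∑-removeOne-unconstrained m _ c _ ∑c≡1+m (∑-#constrainedTo (C ∘ suc)) (#constrained-≤ (C ∘ suc)))
... | just j  | step =
  trans step (∑-removeOne-constrained ((m ∸ #constrained (C ∘ suc)) !) c (#constrainedTo (C ∘ suc)) j)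

-- Distinct tuples and elementary symmetric polynomials

_∈ᵇ_ : ∀ {n k} → Fin n → Vec (Fin n) k → Bool
i ∈ᵇ []      = false
i ∈ᵇ (j ∷ x) = (i =ᶠ j) ∨ (i ∈ᵇ x)

distinct : ∀ {n k} → Vec (Fin n) k → Bool
distinct []      = true
distinct (i ∷ x) = not (i ∈ᵇ x) ∧ distinct x

∈ᵇ-∷ʳ : ∀ {n k} (a : Fin n) (x : Vec (Fin n) k) v → a ∈ᵇ (x ∷ʳ v) ≡ (a ∈ᵇ x) ∨ (a =ᶠ v)
∈ᵇ-∷ʳ a []      v = ∨-identityʳ (a =ᶠ v)
∈ᵇ-∷ʳ a (j ∷ x) v = trans (cong ((a =ᶠ j) ∨_) (∈ᵇ-∷ʳ a x v)) (sym (∨-assoc (a =ᶠ j) _ _))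

distinct-∷ʳ : ∀ {n k} (x : Vec (Fin n) k) v → distinct (x ∷ʳ v) ≡ distinct x ∧ not (v ∈ᵇ x)
distinct-∷ʳ []      v = refl
distinct-∷ʳ (y ∷ x) v rewrite ∈ᵇ-∷ʳ y x v | distinct-∷ʳ x v | =ᶠ-sym y v =
  regroup (y ∈ᵇ x) (v =ᶠ y) (distinct x) (v ∈ᵇ x)
  where
  regroup : ∀ a e b c → not (a ∨ e) ∧ (b ∧ not c) ≡ (not a ∧ b) ∧ not (e ∨ c)
  regroup true  e    b c = refl
  regroup false true b c = sym (∧-zeroʳ b)
  regroup false false b c = refl

distinct⇒∉ : ∀ {n k} (b : Fin n) (x : Vec (Fin n) k) → distinct (b ∷ x) ≡ true → b ∈ᵇ x ≡ false
distinct⇒∉ b x distinct-b∷x with b ∈ᵇ x | distinct-b∷x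
... | false | _ = refl

distinct-tail : ∀ {n k} (x : Vec (Fin n) (suc k)) → distinct x ≡ true → distinct (tail x) ≡ true
distinct-tail (y ∷ x) = ∧-conicalʳ _ _

occurrences-∉ : ∀ {n k} (x : Vec (Fin n) k) b → b ∈ᵇ x ≡ false → occurrences x b ≡ 0
occurrences-∉ []      b _  = refl
occurrences-∉ (c ∷ x) b b∉ with b =ᶠ c | =ᶠ-sym b c | b∉
... | false | false≡c=ᶠb | b∉x rewrite sym false≡c=ᶠb = occurrences-∉ x b b∉x

∏P′-occurrences : ∀ {n k} (d : Fin n → ℕ) (x : Vec (Fin n) k) → distinct x ≡ true →
                  ∏ (λ i → d i P′ occurrences x i) ≡ prodVec d x
∏P′-occurrences {n} d [] _ = ∏-const-1 n
∏P′-occurrences d (b ∷ x) distinct-b∷x =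
  trans (sym (*-identityˡ _))
        (trans (∏-update b 1 (d b) off at) (cong (d b *_) (∏P′-occurrences d x (∧-conicalʳ _ _ distinct-b∷x))))
  where
  off : ∀ i → i ≢ b → d i P′ (𝟙 (b =ᶠ i) + occurrences x i) ≡ d i P′ occurrences x i
  off i i≢b rewrite =ᶠ-≢ (i≢b ∘ sym) = refl
  at : 1 * (d b P′ (𝟙 (b =ᶠ b) + occurrences x b)) ≡ d b * (d b P′ occurrences x b)
  at rewrite =ᶠ-refl b | occurrences-∉ x b (distinct⇒∉ b x distinct-b∷x) = *-identityˡ (d b * 1)

_without_ : ∀ {n} → (Fin n → ℕ) → Fin n → Fin n → ℕ
(w without v) i = if v =ᶠ i then 0 else w i

esym : ∀ {n} → ℕ → (Fin n → ℕ) → ℕ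
esym         zero    w = 1
esym {zero}  (suc k) w = 0
esym {suc n} (suc k) w = esym (suc k) (w ∘ suc) + w zero * esym k (w ∘ suc)

esym-cong : ∀ {n} k {w w′ : Fin n → ℕ} → (∀ i → w i ≡ w′ i) → esym k w ≡ esym k w′
esym-cong         zero    w≗w′ = refl
esym-cong {zero}  (suc k) w≗w′ = refl
esym-cong {suc n} (suc k) w≗w′ =
  cong₂ _+_ (esym-cong (suc k) (w≗w′ ∘ suc)) (cong₂ _*_ (w≗w′ zero) (esym-cong k (w≗w′ ∘ suc)))

esym-head-zero : ∀ {n} k (w : Fin (suc n) → ℕ) → w zero ≡ 0 → esym k w ≡ esym k (w ∘ suc)
esym-head-zero zero    w w₀≡0 = refl
esym-head-zero (suc k) w w₀≡0 rewrite w₀≡0 = +-identityʳ _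

esym-without : ∀ {n} k (w : Fin n → ℕ) v →
               esym (suc k) w ≡ esym (suc k) (w without v) + w v * esym k (w without v)
esym-without k w zero = sym (cong₂ _+_ (esym-head-zero (suc k) (w without zero) refl)
                                       (cong (w zero *_) (esym-head-zero k (w without zero) refl)))
esym-without zero w (suc v) = begin
  esym 1 u + w zero * 1                        ≡⟨ cong (_+ w zero * 1) (esym-without zero u v) ⟩
  esym 1 (u without v) + u v * 1 + w zero * 1  ≡⟨ swap-last (esym 1 (u without v)) (u v * 1) (w zero * 1) ⟩
  esym 1 (u without v) + w zero * 1 + u v * 1  ∎
  where
  open ≡-Reasoning
  u = w ∘ suc
  swap-last : ∀ a b c → a + b + c ≡ a + c + b
  swap-last = solve-∀
esym-without (suc k) w (suc v) = begin
  esym (2 + k) u + w zero * esym (suc k) u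
    ≡⟨ cong₂ (λ a b → a + w zero * b) (esym-without (suc k) u v) (esym-without k u v) ⟩
  A + u v * B + w zero * (B + u v * C)
    ≡⟨ regroup A (u v) B (w zero) C ⟩
  A + w zero * B + u v * (B + w zero * C) ∎
  where
  open ≡-Reasoning
  u = w ∘ suc
  A = esym (2 + k) (u without v)
  B = esym (suc k) (u without v)
  C = esym k (u without v)
  regroup : ∀ A x B w C → A + x * B + w * (B + x * C) ≡ A + w * B + x * (B + w * C)
  regroup = solve-∀

∑-*-esym-without : ∀ {n} k (w : Fin n → ℕ) → ∑[ i < n ] (w i * esym k (w without i)) ≡ suc k * esym (suc k) w
∑-*-esym-without {zero}  k       w = sym (*-zeroʳ (suc k))
∑-*-esym-without {suc n} zero    w = begin
  w zero * 1 + ∑[ i < n ] (u i * 1)  ≡⟨ cong (w zero * 1 +_) (∑-*-esym-without zero u) ⟩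
  w zero * 1 + 1 * esym 1 u          ≡⟨ regroup (w zero) (esym 1 u) ⟩
  1 * (esym 1 u + w zero * 1)        ∎
  where
  open ≡-Reasoning
  u = w ∘ suc
  regroup : ∀ a b → a * 1 + 1 * b ≡ 1 * (b + a * 1)
  regroup = solve-∀
∑-*-esym-without {suc n} (suc k) w = begin
  w zero * esym (suc k) (w without zero) + ∑[ i < n ] (u i * (e₁ i + w zero * e₀ i))
    ≡⟨ cong₂ _+_ (cong (w zero *_) (esym-head-zero (suc k) (w without zero) refl))
                 (sum-cong-≗ λ i → split (u i) (e₁ i) (w zero) (e₀ i)) ⟩
  w zero * B + ∑[ i < n ] (u i * e₁ i + w zero * (u i * e₀ i))
    ≡⟨ cong (w zero * B +_) (∑-distrib-+ (λ i → u i * e₁ i) (λ i → w zero * (u i * e₀ i))) ⟩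
  w zero * B + (∑[ i < n ] (u i * e₁ i) + ∑[ i < n ] (w zero * (u i * e₀ i)))
    ≡⟨ cong (λ z → w zero * B + (∑[ i < n ] (u i * e₁ i) + z))
            (sym (*-distribˡ-sum (w zero) (λ i → u i * e₀ i))) ⟩
  w zero * B + (∑[ i < n ] (u i * e₁ i) + w zero * ∑[ i < n ] (u i * e₀ i))
    ≡⟨ cong₂ (λ a b → w zero * B + (a + w zero * b)) (∑-*-esym-without (suc k) u) (∑-*-esym-without k u) ⟩
  w zero * B + (suc (suc k) * A + w zero * (suc k * B))
    ≡⟨ regroup (w zero) B k A ⟩
  suc (suc k) * (A + w zero * B) ∎
  where
  open ≡-Reasoning
  u = w ∘ suc
  e₁ = λ i → esym (suc k) (u without i)
  e₀ = λ i → esym k (u without i)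
  A = esym (2 + k) u
  B = esym (suc k) u
  split : ∀ x a y b → x * (a + y * b) ≡ x * a + y * (x * b)
  split = solve-∀
  regroup : ∀ w B k A → w * B + (suc (suc k) * A + w * (suc k * B)) ≡ suc (suc k) * (A + w * B)
  regroup = solve-∀

∉-prodVec : ∀ {n k} (w : Fin n → ℕ) i (x : Vec (Fin n) k) →
            𝟙 (not (i ∈ᵇ x)) * prodVec w x ≡ prodVec (w without i) x
∉-prodVec w i []      = refl
∉-prodVec w i (j ∷ x) with i =ᶠ j | =ᶠ-reflects i j
... | true  | ofʸ refl = refl
... | false | ofⁿ _    =
  trans (x*yz≡y*xz (𝟙 (not (i ∈ᵇ x))) (w j) (prodVec w x)) (cong (w j *_) (∉-prodVec w i x))

∑-distinct-prodVec : ∀ {n} k (w : Fin n → ℕ) →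
                     ∑ⱽ k (λ x → 𝟙 (distinct x) * prodVec w x) ≡ k ! * esym k w
∑-distinct-prodVec zero    w = refl
∑-distinct-prodVec {n} (suc k) w = begin
  ∑[ i < n ] ∑ⱽ k (λ x → 𝟙 (not (i ∈ᵇ x) ∧ distinct x) * (w i * prodVec w x))
    ≡⟨ sum-cong-≗ (λ i → trans (∑ⱽ-cong k (λ x → factor-out i x)) (sym (*-distribˡ-∑ⱽ k (w i) _))) ⟩
  ∑[ i < n ] (w i * ∑ⱽ k (λ x → 𝟙 (distinct x) * prodVec (w without i) x))
    ≡⟨ sum-cong-≗ (λ i → cong (w i *_) (∑-distinct-prodVec k (w without i))) ⟩
  ∑[ i < n ] (w i * (k ! * esym k (w without i)))
    ≡⟨ sum-cong-≗ (λ i → x*yz≡y*xz (w i) (k !) _) ⟩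
  ∑[ i < n ] (k ! * (w i * esym k (w without i)))
    ≡⟨ sym (*-distribˡ-sum (k !) (λ i → w i * esym k (w without i))) ⟩
  k ! * ∑[ i < n ] (w i * esym k (w without i))
    ≡⟨ cong (k ! *_) (∑-*-esym-without k w) ⟩
  k ! * (suc k * esym (suc k) w)
    ≡⟨ x*[y*z]≡y*x*z (k !) (suc k) _ ⟩
  suc k ! * esym (suc k) w ∎
  where
  open ≡-Reasoning
  x*[y*z]≡y*x*z : ∀ x y z → x * (y * z) ≡ y * x * z
  x*[y*z]≡y*x*z = solve-∀
  factor-out : ∀ i x → 𝟙 (not (i ∈ᵇ x) ∧ distinct x) * (w i * prodVec w x) ≡
                       w i * (𝟙 (distinct x) * prodVec (w without i) x)
  factor-out i x = begin
    𝟙 (not (i ∈ᵇ x) ∧ distinct x) * (w i * prodVec w x)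
      ≡⟨ cong (_* (w i * prodVec w x)) (𝟙-∧ (not (i ∈ᵇ x)) (distinct x)) ⟩
    𝟙 (not (i ∈ᵇ x)) * 𝟙 (distinct x) * (w i * prodVec w x)
      ≡⟨ shuffle (𝟙 (not (i ∈ᵇ x))) (𝟙 (distinct x)) (w i) (prodVec w x) ⟩
    w i * (𝟙 (distinct x) * (𝟙 (not (i ∈ᵇ x)) * prodVec w x))
      ≡⟨ cong (λ z → w i * (𝟙 (distinct x) * z)) (∉-prodVec w i x) ⟩
    w i * (𝟙 (distinct x) * prodVec (w without i) x) ∎
    where
    shuffle : ∀ a b c d → a * b * (c * d) ≡ c * (b * (a * d))
    shuffle = solve-∀

_from_ : ∀ {n} → (Fin n → ℕ) → ℕ → Fin n → ℕ
(w from lo) j = if lo ≤ᵇ toℕ j then w j else 0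

startsFrom : ∀ {n k} → ℕ → Vec (Fin n) k → Bool
startsFrom lo []      = true
startsFrom lo (i ∷ _) = lo ≤ᵇ toℕ i

increasing-∷ : ∀ {n k} (i : Fin n) (x : Vec (Fin n) k) →
               increasing (i ∷ x) ≡ increasing x ∧ startsFrom (suc (toℕ i)) x
increasing-∷ i []      = refl
increasing-∷ i (j ∷ x) = ∧-comm (toℕ i <ᵇ toℕ j) (increasing (j ∷ x))

from-from : ∀ {n} (w : Fin n → ℕ) {lo} (i : Fin n) → lo ≤ toℕ i →
            ∀ j → ((w from lo) from suc (toℕ i)) j ≡ (w from suc (toℕ i)) j
from-from w {lo} i lo≤i j
  with suc (toℕ i) ≤ᵇ toℕ j | ≤ᵇ-reflects-≤ (suc (toℕ i)) (toℕ j)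
     | lo ≤ᵇ toℕ j          | ≤ᵇ-reflects-≤ lo (toℕ j)
... | false | _       | _     | _         = refl
... | true  | _       | true  | _         = refl
... | true  | ofʸ i<j | false | ofⁿ lo≰j = contradiction (≤-trans lo≤i (<⇒≤ i<j)) lo≰j

esym-suc-from : ∀ {n} k (w : Fin n → ℕ) → esym (suc k) w ≡ ∑[ i < n ] (w i * esym k (w from suc (toℕ i)))
esym-suc-from {zero}  k w = refl
esym-suc-from {suc n} k w = begin
  esym (suc k) u + w zero * esym k u
    ≡⟨ +-comm (esym (suc k) u) _ ⟩
  w zero * esym k u + esym (suc k) u
    ≡⟨ cong₂ _+_ (cong (w zero *_) (sym (esym-head-zero k (w from 1) refl)))
                 (trans (esym-suc-from k u)
                        (sum-cong-≗ λ i → cong (u i *_) (sym (esym-head-zero k (w from suc (suc (toℕ i))) refl)))) ⟩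
  w zero * esym k (w from 1) + ∑[ i < n ] (u i * esym k (w from suc (suc (toℕ i)))) ∎
  where
  open ≡-Reasoning
  u = w ∘ suc

∑-increasing-from : ∀ {n} k lo (w : Fin n → ℕ) →
                    ∑ⱽ k (λ x → 𝟙 (increasing x ∧ startsFrom lo x) * prodVec w x) ≡ esym k (w from lo)
∑-increasing-from         zero    lo w = refl
∑-increasing-from {n} (suc k) lo w = begin
  ∑[ i < n ] ∑ⱽ k (λ x → 𝟙 (increasing (i ∷ x) ∧ (lo ≤ᵇ toℕ i)) * (w i * prodVec w x))
    ≡⟨ sum-cong-≗ (λ i → trans (∑ⱽ-cong k (factor-out i)) (sym (*-distribˡ-∑ⱽ k ((w from lo) i) _))) ⟩
  ∑[ i < n ] ((w from lo) i * ∑ⱽ k (λ x → 𝟙 (increasing x ∧ startsFrom (suc (toℕ i)) x) * prodVec w x))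
    ≡⟨ sum-cong-≗ (λ i → cong ((w from lo) i *_) (∑-increasing-from k (suc (toℕ i)) w)) ⟩
  ∑[ i < n ] ((w from lo) i * esym k (w from suc (toℕ i)))
    ≡⟨ sum-cong-≗ restrict ⟩
  ∑[ i < n ] ((w from lo) i * esym k ((w from lo) from suc (toℕ i)))
    ≡⟨ sym (esym-suc-from k (w from lo)) ⟩
  esym (suc k) (w from lo) ∎
  where
  open ≡-Reasoning
  shuffle : ∀ a c d → a * 1 * (c * d) ≡ c * (a * d)
  shuffle = solve-∀
  factor-out : ∀ i x → 𝟙 (increasing (i ∷ x) ∧ (lo ≤ᵇ toℕ i)) * (w i * prodVec w x) ≡
                       (w from lo) i * (𝟙 (increasing x ∧ startsFrom (suc (toℕ i)) x) * prodVec w x)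
  factor-out i x rewrite increasing-∷ i x | 𝟙-∧ (increasing x ∧ startsFrom (suc (toℕ i)) x) (lo ≤ᵇ toℕ i)
    with lo ≤ᵇ toℕ i
  ... | true  = shuffle (𝟙 (increasing x ∧ startsFrom (suc (toℕ i)) x)) (w i) (prodVec w x)
  ... | false = cong (_* (w i * prodVec w x)) (*-zeroʳ (𝟙 (increasing x ∧ startsFrom (suc (toℕ i)) x)))
  restrict : ∀ i → (w from lo) i * esym k (w from suc (toℕ i)) ≡
                   (w from lo) i * esym k ((w from lo) from suc (toℕ i))
  restrict i with lo ≤ᵇ toℕ i | ≤ᵇ-reflects-≤ lo (toℕ i)
  ... | true  | ofʸ lo≤i = cong (w i *_) (esym-cong k (λ j → sym (from-from w {lo} i lo≤i j)))
  ... | false | _        = refl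

incSum≡esym : ∀ {n} (d : Fin n → ℕ) k → incSum d k ≡ esym k d
incSum≡esym {n} d k = begin
  incSum d k
    ≡⟨ sum-map-filterᵇ increasing (prodVec d) (allVecs k n) ⟩
  sum (map (λ x → 𝟙 (increasing x) * prodVec d x) (allVecs k n))
    ≡⟨ sum-map-allVecs k n _ ⟩
  ∑ⱽ k (λ x → 𝟙 (increasing x) * prodVec d x)
    ≡⟨ ∑ⱽ-cong k (λ x → cong (λ b → 𝟙 b * prodVec d x)
                             (sym (trans (cong (increasing x ∧_) (startsFrom-0 x)) (∧-identityʳ _)))) ⟩
  ∑ⱽ k (λ x → 𝟙 (increasing x ∧ startsFrom 0 x) * prodVec d x)
    ≡⟨ ∑-increasing-from k 0 d ⟩
  esym k (d from 0) ∎
  where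
  open ≡-Reasoning
  startsFrom-0 : ∀ {k} (x : Vec (Fin n) k) → startsFrom 0 x ≡ true
  startsFrom-0 []      = refl
  startsFrom-0 (_ ∷ _) = refl

!*incSum-without : ∀ {n} (d : Fin n → ℕ) v k →
                   suc k ! * incSum d (suc k) ≡
                   suc k ! * esym (suc k) (d without v) + suc k * d v * (k ! * esym k (d without v))
!*incSum-without d v k =
  trans (cong (suc k ! *_) (trans (incSum≡esym d (suc k)) (esym-without k d v))) (distrib (k !) k _ _ (d v))
  where
  distrib : ∀ K k e₁ e₀ x → suc k * K * (e₁ + x * e₀) ≡ suc k * K * e₁ + suc k * x * (K * e₀)
  distrib = solve-∀

-- Paths, orbits and the six-length

sends : ∀ {n k} → Map n → Vec (Fin n) k → Vec (Fin n) k → ℕ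
sends f []       []       = 1
sends f (a ∷ as) (b ∷ bs) = 𝟙 (app f a =ᶠ b) * sends f as bs

-- For x = (x_k, …, x_1): 1 if f v = x_1, f x_1 = x_2, …, f x_{k-1} = x_k, and 0 otherwise.
follows : ∀ {n k} → Map n → Fin n → Vec (Fin n) k → ℕ
follows f v x = sends f (tail (x ∷ʳ v)) x

prescribe : ∀ {n k} → Vec (Fin n) k → Vec (Fin n) k → Constraint n n
prescribe []       []       p = nothing
prescribe (a ∷ as) (b ∷ bs) p = if p =ᶠ a then just b else prescribe as bs p

module _ {n k : ℕ} (a b : Fin n) (as bs : Vec (Fin n) k) where

  prescribe-≢ : ∀ {p} → p ≢ a → prescribe (a ∷ as) (b ∷ bs) p ≡ prescribe as bs p
  prescribe-≢ p≢a rewrite =ᶠ-≢ p≢a = refl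

  prescribe-∉ : ∀ {p} → p ∈ᵇ as ≡ false → prescribe as bs p ≡ nothing
  prescribe-∉ {p} p∉as = go as bs p∉as
    where
    go : ∀ {k} (as bs : Vec (Fin n) k) → p ∈ᵇ as ≡ false → prescribe as bs p ≡ nothing
    go []       []       _    = refl
    go (a′ ∷ as) (b′ ∷ bs) p∉ with p =ᶠ a′ | p∉
    ... | false | p∉as′ = go as bs p∉as′

  module _ (distinct-a∷as : distinct (a ∷ as) ≡ true) where

    prescribe-at : prescribe as bs a ≡ nothing
    prescribe-at = prescribe-∉ (distinct⇒∉ a as distinct-a∷as)

    satisfies-prescribe-∷ : ∀ f → satisfies (prescribe (a ∷ as) (b ∷ bs)) f ≡
                                  𝟙 (app f a =ᶠ b) * satisfies (prescribe as bs) f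
    satisfies-prescribe-∷ f = trans (sym (*-identityˡ _)) (∏-update a 1 (𝟙 (app f a =ᶠ b)) off at)
      where
      off : ∀ p → p ≢ a → meets (prescribe (a ∷ as) (b ∷ bs) p) (lookup f p) ≡
                          meets (prescribe as bs p) (lookup f p)
      off p p≢a = cong (λ C → meets C (lookup f p)) (prescribe-≢ p≢a)
      at : 1 * meets (prescribe (a ∷ as) (b ∷ bs) a) (lookup f a) ≡
           𝟙 (app f a =ᶠ b) * meets (prescribe as bs a) (lookup f a)
      at rewrite =ᶠ-refl a | prescribe-at = trans (*-identityˡ _) (sym (*-identityʳ _))

    #constrained-prescribe-∷ : #constrained (prescribe (a ∷ as) (b ∷ bs)) ≡ suc (#constrained (prescribe as bs))
    #constrained-prescribe-∷ = ∑-update a 0 1 (λ p p≢a → cong (𝟙 ∘ is-just) (prescribe-≢ p≢a)) at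
      where
      at : 𝟙 (is-just (prescribe (a ∷ as) (b ∷ bs) a)) ≡ 1 + 𝟙 (is-just (prescribe as bs a))
      at rewrite =ᶠ-refl a | prescribe-at = refl

    #constrainedTo-prescribe-∷ : ∀ i → #constrainedTo (prescribe (a ∷ as) (b ∷ bs)) i ≡
                                       𝟙 (b =ᶠ i) + #constrainedTo (prescribe as bs) i
    #constrainedTo-prescribe-∷ i =
      ∑-update a 0 (𝟙 (b =ᶠ i)) (λ p p≢a → cong (λ C → pointsTo C i) (prescribe-≢ p≢a)) at
      where
      at : pointsTo (prescribe (a ∷ as) (b ∷ bs) a) i ≡ 𝟙 (b =ᶠ i) + pointsTo (prescribe as bs a) i
      at rewrite =ᶠ-refl a | prescribe-at | =ᶠ-sym i b = sym (+-identityʳ _)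

module _ {n : ℕ} where

  satisfies-prescribe : ∀ {k} (as bs : Vec (Fin n) k) → distinct as ≡ true →
                        ∀ f → satisfies (prescribe as bs) f ≡ sends f as bs
  satisfies-prescribe []       []       _           f = ∏-const-1 n
  satisfies-prescribe (a ∷ as) (b ∷ bs) distinct-as f =
    trans (satisfies-prescribe-∷ a b as bs distinct-as f)
          (cong (𝟙 (app f a =ᶠ b) *_) (satisfies-prescribe as bs (∧-conicalʳ _ _ distinct-as) f))

  #constrained-prescribe : ∀ {k} (as bs : Vec (Fin n) k) → distinct as ≡ true → #constrained (prescribe as bs) ≡ k
  #constrained-prescribe []       []       _           = sum-replicate-zero n
  #constrained-prescribe (a ∷ as) (b ∷ bs) distinct-as =
    trans (#constrained-prescribe-∷ a b as bs distinct-as)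
          (cong suc (#constrained-prescribe as bs (∧-conicalʳ _ _ distinct-as)))

  #constrainedTo-prescribe : ∀ {k} (as bs : Vec (Fin n) k) → distinct as ≡ true →
                             ∀ i → #constrainedTo (prescribe as bs) i ≡ occurrences bs i
  #constrainedTo-prescribe []       []       _           i = sum-replicate-zero n
  #constrainedTo-prescribe (a ∷ as) (b ∷ bs) distinct-as i =
    trans (#constrainedTo-prescribe-∷ a b as bs distinct-as i)
          (cong (𝟙 (b =ᶠ i) +_) (#constrainedTo-prescribe as bs (∧-conicalʳ _ _ distinct-as) i))

any-∷ʳ : ∀ {A : Set} (p : A → Bool) xs x → any p (xs List.∷ʳ x) ≡ any p xs ∨ p x
any-∷ʳ p []       x = ∨-identityʳ (p x)
any-∷ʳ p (y ∷ xs) x = trans (cong (p y ∨_) (any-∷ʳ p xs x)) (sym (∨-assoc (p y) _ _))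

-- (f^k v, …, f v), latest first; iterates f v k ∷ʳ v is the orbit of v up to f^k v.
iterates : ∀ {n} → Map n → Fin n → (k : ℕ) → Vec (Fin n) k
iterates f v zero    = []
iterates f v (suc k) = iter f (suc k) v ∷ iterates f v k

module _ {n : ℕ} (f : Map n) (v : Fin n) where

  ∈ᵇ-orbit : ∀ a k → a ∈ᵇ (iterates f v k ∷ʳ v) ≡ any (λ j → a =ᶠ iter f j v) (upTo (suc k))
  ∈ᵇ-orbit a zero    = refl
  ∈ᵇ-orbit a (suc k) = begin
    (a =ᶠ iter f (suc k) v) ∨ (a ∈ᵇ (iterates f v k ∷ʳ v))  ≡⟨ cong (p (suc k) ∨_) (∈ᵇ-orbit a k) ⟩
    p (suc k) ∨ any p (upTo (suc k))                        ≡⟨ ∨-comm (p (suc k)) _ ⟩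
    any p (upTo (suc k)) ∨ p (suc k)                        ≡⟨ sym (any-∷ʳ p (upTo (suc k)) (suc k)) ⟩
    any p (upTo (suc k) List.∷ʳ suc k)                      ≡⟨ cong (any p) (upTo-∷ʳ (suc k)) ⟩
    any p (upTo (suc (suc k)))                              ∎
    where
    open ≡-Reasoning
    p = λ j → a =ᶠ iter f j v

  orbitDistinct : ℕ → Bool
  orbitDistinct k = distinct (iterates f v k ∷ʳ v)

  orbitDistinct-suc : ∀ k → orbitDistinct (suc k) ≡ not (repeatsAt f v (suc k)) ∧ orbitDistinct k
  orbitDistinct-suc k = cong (λ b → not b ∧ orbitDistinct k) (∈ᵇ-orbit (iter f (suc k) v) k)

  orbitDistinct-false : ∀ {t k} → repeatsAt f v (suc t) ≡ true → t < k → orbitDistinct k ≡ false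
  orbitDistinct-false {t} {suc k} repeats t<1+k with m<1+n⇒m<n∨m≡n t<1+k
  ... | inj₂ refl rewrite orbitDistinct-suc t | repeats = refl
  ... | inj₁ t<k  rewrite orbitDistinct-suc k | orbitDistinct-false repeats t<k = ∧-zeroʳ _

  search-≥ : ∀ s fuel → s ≤ search f v s fuel
  search-≥ s zero       = ≤-refl
  search-≥ s (suc fuel) with repeatsAt f v s
  ... | true  = ≤-refl
  ... | false = ≤-trans (n≤1+n s) (search-≥ (suc s) fuel)

  search-spec : ∀ fuel s k → s ≤ k → k ≤ s + fuel → orbitDistinct s ≡ true →
                (k <ᵇ search f v (suc s) fuel) ≡ orbitDistinct k
  search-spec zero s k s≤k k≤s+0 distinctₛ with ≤-antisym s≤k (≤-trans k≤s+0 (≤-reflexive (+-identityʳ s)))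
  ... | refl = trans (det (<ᵇ-reflects-< s (suc s)) (ofʸ ≤-refl)) (sym distinctₛ)
  search-spec (suc fuel) s k s≤k k≤s+1+fuel distinctₛ with m≤n⇒m<n∨m≡n s≤k
  ... | inj₂ refl = trans (det (<ᵇ-reflects-< s _) (ofʸ (search-≥ (suc s) (suc fuel)))) (sym distinctₛ)
  ... | inj₁ s<k with repeatsAt f v (suc s) in repeats
  ...   | true  = trans (det (<ᵇ-reflects-< k (suc s)) (ofⁿ (<⇒≱ s<k ∘ ≤-pred)))
                        (sym (orbitDistinct-false repeats s<k))
  ...   | false = search-spec fuel (suc s) k s<k (≤-trans k≤s+1+fuel (≤-reflexive (+-suc s fuel)))
                  (trans (trans (orbitDistinct-suc s) (cong (λ b → not b ∧ orbitDistinct s) repeats)) distinctₛ)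

  sixLength-spec : ∀ k → k ≤ n → (k <ᵇ sixLength f v) ≡ orbitDistinct k
  sixLength-spec k k≤n = search-spec (suc n) 0 k z≤n (≤-trans k≤n (n≤1+n n)) refl


  follows-∷ : ∀ {k} y (x : Vec (Fin n) k) →
                 follows f v (y ∷ x) ≡ 𝟙 (app f (head (x ∷ʳ v)) =ᶠ y) * follows f v x
  follows-∷ y []      = refl
  follows-∷ y (z ∷ x) = refl

  head-iterates : ∀ k → head (iterates f v k ∷ʳ v) ≡ iter f k v
  head-iterates zero    = refl
  head-iterates (suc k) = refl

  follows-iterates : ∀ k → follows f v (iterates f v k) ≡ 1
  follows-iterates zero    = refl
  follows-iterates (suc k) = begin
    follows f v (iterates f v (suc k))
      ≡⟨ follows-∷ (iter f (suc k) v) (iterates f v k) ⟩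
    𝟙 (app f (head (iterates f v k ∷ʳ v)) =ᶠ iter f (suc k) v) * follows f v (iterates f v k)
      ≡⟨ cong₂ (λ a b → 𝟙 (app f a =ᶠ iter f (suc k) v) * b) (head-iterates k) (follows-iterates k) ⟩
    𝟙 (iter f (suc k) v =ᶠ iter f (suc k) v) * 1
      ≡⟨ cong (λ b → 𝟙 b * 1) (=ᶠ-refl (iter f (suc k) v)) ⟩
    1 ∎
    where open ≡-Reasoning

  follows-not-iterates : ∀ k (x : Vec (Fin n) k) → x ≢ iterates f v k → follows f v x ≡ 0
  follows-not-iterates zero    []      x≢[] = contradiction refl x≢[]
  follows-not-iterates (suc k) (y ∷ x) y∷x≢ rewrite follows-∷ y x with ≡-dec _≟ᶠ_ x (iterates f v k)
  ... | yes refl rewrite head-iterates k | =ᶠ-≢ (λ fy≡y → y∷x≢ (cong (_∷ x) (sym fy≡y))) = refl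
  ... | no x≢    rewrite follows-not-iterates k x x≢ = *-zeroʳ (𝟙 (app f (head (x ∷ʳ v)) =ᶠ y))

  𝟙-orbitDistinct : ∀ k → 𝟙 (orbitDistinct k) ≡ ∑ⱽ k (λ x → 𝟙 (distinct (x ∷ʳ v)) * follows f v x)
  𝟙-orbitDistinct k = sym (begin
    ∑ⱽ k (λ x → 𝟙 (distinct (x ∷ʳ v)) * follows f v x)
      ≡⟨ ∑ⱽ-single k (iterates f v k) (λ x x≢ →
           trans (cong (𝟙 (distinct (x ∷ʳ v)) *_) (follows-not-iterates k x x≢)) (*-zeroʳ (𝟙 (distinct (x ∷ʳ v))))) ⟩
    𝟙 (orbitDistinct k) * follows f v (iterates f v k)
      ≡⟨ cong (𝟙 (orbitDistinct k) *_) (follows-iterates k) ⟩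
    𝟙 (orbitDistinct k) * 1
      ≡⟨ *-identityʳ _ ⟩
    𝟙 (orbitDistinct k) ∎)
    where open ≡-Reasoning

-- Counting maps with prescribed in-degrees

preimageSize≡occurrences : ∀ {n} (f : Map n) i → preimageSize f i ≡ occurrences f i
preimageSize≡occurrences {n} f i =
  trans (length-filterᵇ (λ j → app f j =ᶠ i) (allFin n)) (sum-map-tabulate id (λ j → 𝟙 (app f j =ᶠ i)))

𝟙-hasDegrees : ∀ {n} (d : Fin n → ℕ) f → 𝟙 (hasDegrees d f) ≡ fits d f
𝟙-hasDegrees {n} d f = trans (𝟙-all-tabulate (λ i → preimageSize f i ≡ᵇ d i) (id {A = Fin n}))
                             (∏-cong {n} λ i → cong (λ m → 𝟙 (m ≡ᵇ d i)) (preimageSize≡occurrences f i))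

length-filterᵇ-𝔉 : ∀ {n} (d : Fin n → ℕ) (p : Map n → Bool) →
                   length (filterᵇ p (𝔉 d)) ≡ ∑ⱽ n (λ f → fits d f * 𝟙 (p f))
length-filterᵇ-𝔉 {n} d p = begin
  length (filterᵇ p (𝔉 d))
    ≡⟨ length-filterᵇ p (𝔉 d) ⟩
  sum (map (𝟙 ∘ p) (filterᵇ (hasDegrees d) (allVecs n n)))
    ≡⟨ sum-map-filterᵇ (hasDegrees d) (𝟙 ∘ p) (allVecs n n) ⟩
  sum (map (λ f → 𝟙 (hasDegrees d f) * 𝟙 (p f)) (allVecs n n))
    ≡⟨ sum-map-allVecs n n _ ⟩
  ∑ⱽ n (λ f → 𝟙 (hasDegrees d f) * 𝟙 (p f))
    ≡⟨ ∑ⱽ-cong n (λ f → cong (_* 𝟙 (p f)) (𝟙-hasDegrees d f)) ⟩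
  ∑ⱽ n (λ f → fits d f * 𝟙 (p f)) ∎
  where open ≡-Reasoning

length-𝔉*∏!≡n! : ∀ {n} (d : Fin n → ℕ) → ∑ d ≡ n → length (𝔉 d) * ∏ (λ i → d i !) ≡ n !
length-𝔉*∏!≡n! {n} d ∑d≡n = begin
  length (𝔉 d) * ∏ (λ i → d i !)
    ≡⟨ cong (_* ∏ (λ i → d i !)) (trans (length-filterᵇ (hasDegrees d) (allVecs n n)) (sum-map-allVecs n n _)) ⟩
  ∑ⱽ n (λ f → 𝟙 (hasDegrees d f)) * ∏ (λ i → d i !)
    ≡⟨ cong (_* ∏ (λ i → d i !)) (∑ⱽ-cong n λ f →
         trans (𝟙-hasDegrees d f) (sym (trans (cong (fits d f *_) (∏-const-1 n)) (*-identityʳ _)))) ⟩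
  #fillings n d (λ _ → nothing) * ∏ (λ i → d i !)
    ≡⟨ fillings-formula n d (λ _ → nothing) ∑d≡n ⟩
  (n ∸ ∑[ p < n ] 0) ! * ∏ (λ i → d i P′ ∑[ p < n ] 0)
    ≡⟨ cong₂ (λ a b → (n ∸ a) ! * ∏ (λ i → d i P′ b)) (sum-replicate-zero n) (sum-replicate-zero n) ⟩
  n ! * ∏ {n} (λ _ → 1)
    ≡⟨ trans (cong (n ! *_) (∏-const-1 n)) (*-identityʳ (n !)) ⟩
  n ! ∎
  where open ≡-Reasoning

length-𝔉≢0 : ∀ {n} (d : Fin n → ℕ) → ∑ d ≡ n → length (𝔉 d) ≢ 0
length-𝔉≢0 {n} d ∑d≡n N≡0 =
  ≢-nonZero⁻¹ (n !) {{n !≢0}} (trans (sym (length-𝔉*∏!≡n! d ∑d≡n)) (cong (_* ∏ (λ i → d i !)) N≡0))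

fillings-along-path : ∀ {n k} (d : Fin n → ℕ) → ∑ d ≡ n →
                      ∀ v (x : Vec (Fin n) k) → distinct (x ∷ʳ v) ≡ true →
                      ∑ⱽ n (λ f → fits d f * follows f v x) * ∏ (λ i → d i !) ≡ (n ∸ k) ! * prodVec d x
fillings-along-path {n} {k} d ∑d≡n v x distinct-path = begin
  ∑ⱽ n (λ f → fits d f * follows f v x) * ∏ (λ i → d i !)
    ≡⟨ cong (_* ∏ (λ i → d i !))
            (∑ⱽ-cong n λ f → cong (fits d f *_) (sym (satisfies-prescribe sources x distinct-sources f))) ⟩
  #fillings n d (prescribe sources x) * ∏ (λ i → d i !)
    ≡⟨ fillings-formula n d (prescribe sources x) ∑d≡n ⟩
  (n ∸ #constrained (prescribe sources x)) ! * ∏ (λ i → d i P′ #constrainedTo (prescribe sources x) i)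
    ≡⟨ cong₂ (λ a b → (n ∸ a) ! * b) (#constrained-prescribe sources x distinct-sources)
             (∏-cong λ i → cong (d i P′_) (#constrainedTo-prescribe sources x distinct-sources i)) ⟩
  (n ∸ k) ! * ∏ (λ i → d i P′ occurrences x i)
    ≡⟨ cong ((n ∸ k) ! *_) (∏P′-occurrences d x distinct-x) ⟩
  (n ∸ k) ! * prodVec d x ∎
  where
  open ≡-Reasoning
  sources = tail (x ∷ʳ v)
  distinct-sources = distinct-tail (x ∷ʳ v) distinct-path
  distinct-x = ∧-conicalˡ _ _ (trans (sym (distinct-∷ʳ x v)) distinct-path)

-- 𝔰_f(v) > k exactly when f follows some path x from v with v, x_1, …, x_k distinct.
sixLength>-count : ∀ {n} (d : Fin n → ℕ) → ∑ d ≡ n → ∀ v k → k ≤ n →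
                 length (filterᵇ (λ f → k <ᵇ sixLength f v) (𝔉 d)) * ∏ (λ i → d i !) ≡
                 (n ∸ k) ! * (k ! * esym k (d without v))
sixLength>-count {n} d ∑d≡n v k k≤n = begin
  length (filterᵇ (λ f → k <ᵇ sixLength f v) (𝔉 d)) * Π
    ≡⟨ cong (_* Π) (length-filterᵇ-𝔉 d _) ⟩
  ∑ⱽ n (λ f → fits d f * 𝟙 (k <ᵇ sixLength f v)) * Π
    ≡⟨ cong (_* Π) (∑ⱽ-cong n λ f →
         cong (fits d f *_) (trans (cong 𝟙 (sixLength-spec f v k k≤n)) (𝟙-orbitDistinct f v k))) ⟩
  ∑ⱽ n (λ f → fits d f * ∑ⱽ k (λ x → D x * S f x)) * Π
    ≡⟨ cong (_* Π) (∑ⱽ-cong n λ f →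
         trans (*-distribˡ-∑ⱽ k (fits d f) _) (∑ⱽ-cong k λ x → x*yz≡y*xz (fits d f) (D x) (S f x))) ⟩
  ∑ⱽ n (λ f → ∑ⱽ k (λ x → D x * (fits d f * S f x))) * Π
    ≡⟨ cong (_* Π) (trans (∑ⱽ-comm n k _) (∑ⱽ-cong k λ x → sym (*-distribˡ-∑ⱽ n (D x) _))) ⟩
  ∑ⱽ k (λ x → D x * F x) * Π
    ≡⟨ trans (*-comm _ Π) (*-distribˡ-∑ⱽ k Π _) ⟩
  ∑ⱽ k (λ x → Π * (D x * F x))
    ≡⟨ ∑ⱽ-cong k per-path ⟩
  ∑ⱽ k (λ x → (n ∸ k) ! * (𝟙 (distinct x) * prodVec (d without v) x))
    ≡⟨ sym (*-distribˡ-∑ⱽ k ((n ∸ k) !) _) ⟩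
  (n ∸ k) ! * ∑ⱽ k (λ x → 𝟙 (distinct x) * prodVec (d without v) x)
    ≡⟨ cong ((n ∸ k) ! *_) (∑-distinct-prodVec k (d without v)) ⟩
  (n ∸ k) ! * (k ! * esym k (d without v)) ∎
  where
  open ≡-Reasoning
  Π = ∏ (λ i → d i !)
  D = λ (x : Vec (Fin n) k) → 𝟙 (distinct (x ∷ʳ v))
  S = λ f (x : Vec (Fin n) k) → follows f v x
  F = λ x → ∑ⱽ n (λ f → fits d f * S f x)
  per-path : ∀ x → Π * (D x * F x) ≡ (n ∸ k) ! * (𝟙 (distinct x) * prodVec (d without v) x)
  per-path x = begin
    Π * (D x * F x)
      ≡⟨ x*yz≡y*xz Π (D x) (F x) ⟩
    D x * (Π * F x)
      ≡⟨ 𝟙-guard (distinct (x ∷ʳ v)) (λ distinct-path →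
           trans (*-comm Π (F x)) (fillings-along-path d ∑d≡n v x distinct-path)) ⟩
    D x * ((n ∸ k) ! * prodVec d x)
      ≡⟨ x*yz≡y*xz (D x) ((n ∸ k) !) (prodVec d x) ⟩
    (n ∸ k) ! * (D x * prodVec d x)
      ≡⟨ cong (λ b → (n ∸ k) ! * (𝟙 b * prodVec d x)) (distinct-∷ʳ x v) ⟩
    (n ∸ k) ! * (𝟙 (distinct x ∧ not (v ∈ᵇ x)) * prodVec d x)
      ≡⟨ cong ((n ∸ k) ! *_) (trans (cong (_* prodVec d x) (𝟙-∧ (distinct x) _)) (*-assoc (𝟙 (distinct x)) _ _)) ⟩
    (n ∸ k) ! * (𝟙 (distinct x) * (𝟙 (not (v ∈ᵇ x)) * prodVec d x))
      ≡⟨ cong (λ z → (n ∸ k) ! * (𝟙 (distinct x) * z)) (∉-prodVec d v x) ⟩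
    (n ∸ k) ! * (𝟙 (distinct x) * prodVec (d without v) x) ∎

sixLength>-ratio : ∀ {n} (d : Fin n → ℕ) → ∑ d ≡ n → ∀ v j → j ≤ n →
                   length (filterᵇ (λ f → j <ᵇ sixLength f v) (𝔉 d)) * (n P j) ≡
                   length (𝔉 d) * (j ! * esym j (d without v))
sixLength>-ratio {n} d ∑d≡n v j j≤n = *-cancelʳ-≡ (A * (n P j)) (N * T) ((n ∸ j) ! * Π) {{nonZero}} (begin
  A * (n P j) * ((n ∸ j) ! * Π)      ≡⟨ regroup A (n P j) ((n ∸ j) !) Π ⟩
  A * Π * ((n P j) * (n ∸ j) !)      ≡⟨ cong₂ _*_ (sixLength>-count d ∑d≡n v j j≤n) (P*[n∸k]!≡n! j≤n) ⟩
  (n ∸ j) ! * T * n !                ≡⟨ cong ((n ∸ j) ! * T *_) (sym (length-𝔉*∏!≡n! d ∑d≡n)) ⟩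
  (n ∸ j) ! * T * (N * Π)            ≡⟨ regroup′ ((n ∸ j) !) T N Π ⟩
  N * T * ((n ∸ j) ! * Π)            ∎)
  where
  open ≡-Reasoning
  N = length (𝔉 d)
  A = length (filterᵇ (λ f → j <ᵇ sixLength f v) (𝔉 d))
  T = j ! * esym j (d without v)
  Π = ∏ (λ i → d i !)
  nonZero : NonZero ((n ∸ j) ! * Π)
  nonZero = m*n≢0 _ _ {{(n ∸ j) !≢0}} {{m*n≢0⇒n≢0 N {{N*Π≢0}}}}
    where N*Π≢0 = subst NonZero (sym (length-𝔉*∏!≡n! d ∑d≡n)) (n !≢0)
  regroup : ∀ a q f p → a * q * (f * p) ≡ a * p * (q * f)
  regroup = solve-∀
  regroup′ : ∀ f t N p → f * t * (N * p) ≡ N * t * (f * p)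
  regroup′ = solve-∀

frac-≃ : ∀ a b → toℚᵘ (frac a (suc b)) ℚᵘ.≃ mkℚᵘ (ℤ.+ a) b
frac-≃ a b = toℚᵘ-fromℚᵘ (mkℚᵘ (ℤ.+ a) b)

frac-cong : ∀ a b c d → a * suc d ≡ c * suc b → frac a (suc b) ≡ frac c (suc d)
frac-cong a b c d eq = fromℚᵘ-cong {mkℚᵘ (ℤ.+ a) b} {mkℚᵘ (ℤ.+ c) d}
  (*≡* (trans (sym (pos-* a (suc d))) (trans (cong ℤ.+_ eq) (pos-* c (suc b)))))

frac-+ : ∀ a b c d → frac a (suc b) ℚ.+ frac c (suc d) ≡ frac (a * suc d + c * suc b) (suc b * suc d)
frac-+ a b c d = toℚᵘ-injective (begin
  toℚᵘ (frac a (suc b) ℚ.+ frac c (suc d))            ≈⟨ toℚᵘ-homo-+ (frac a (suc b)) (frac c (suc d)) ⟩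
  toℚᵘ (frac a (suc b)) ℚᵘ.+ toℚᵘ (frac c (suc d))    ≈⟨ ℚᵘ.+-cong (frac-≃ a b) (frac-≃ c d) ⟩
  mkℚᵘ (ℤ.+ a) b ℚᵘ.+ mkℚᵘ (ℤ.+ c) d                  ≡⟨ cong (λ z → mkℚᵘ z (d + b * suc d)) numerator ⟩
  mkℚᵘ (ℤ.+ (a * suc d + c * suc b)) (d + b * suc d)  ≈⟨ ℚᵘ.≃-sym (frac-≃ _ (d + b * suc d)) ⟩
  toℚᵘ (frac (a * suc d + c * suc b) (suc b * suc d)) ∎)
  where
  open ℚᵘ.≃-Reasoning
  numerator : ℤ.+ a ℤ.* ℤ.+ suc d ℤ.+ ℤ.+ c ℤ.* ℤ.+ suc b ≡ ℤ.+ (a * suc d + c * suc b)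
  numerator = trans (cong₂ ℤ._+_ (sym (pos-* a (suc d))) (sym (pos-* c (suc b)))) (sym (pos-+ (a * suc d) (c * suc b)))

frac-* : ∀ a b c d → frac a (suc b) ℚ.* frac c (suc d) ≡ frac (a * c) (suc b * suc d)
frac-* a b c d = toℚᵘ-injective (begin
  toℚᵘ (frac a (suc b) ℚ.* frac c (suc d))          ≈⟨ toℚᵘ-homo-* (frac a (suc b)) (frac c (suc d)) ⟩
  toℚᵘ (frac a (suc b)) ℚᵘ.* toℚᵘ (frac c (suc d))  ≈⟨ ℚᵘ.*-cong (frac-≃ a b) (frac-≃ c d) ⟩
  mkℚᵘ (ℤ.+ a) b ℚᵘ.* mkℚᵘ (ℤ.+ c) d                ≡⟨ cong (λ z → mkℚᵘ z (d + b * suc d)) (sym (pos-* a c)) ⟩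
  mkℚᵘ (ℤ.+ (a * c)) (d + b * suc d)                ≈⟨ ℚᵘ.≃-sym (frac-≃ (a * c) (d + b * suc d)) ⟩
  toℚᵘ (frac (a * c) (suc b * suc d))               ∎)
  where open ℚᵘ.≃-Reasoning

frac-+-*-frac : ∀ a b c e N S Q → (a * suc S + b * c) * suc Q ≡ e * (suc S * suc N) →
                frac a (suc N) ℚ.+ frac b (suc S) ℚ.* frac c (suc N) ≡ frac e (suc Q)
frac-+-*-frac a b c e N S Q cross = begin
  frac a (suc N) ℚ.+ frac b (suc S) ℚ.* frac c (suc N)
    ≡⟨ cong (frac a (suc N) ℚ.+_) (frac-* b S c N) ⟩
  frac a (suc N) ℚ.+ frac (b * c) (suc S * suc N)
    ≡⟨ frac-+ a N (b * c) (N + S * suc N) ⟩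
  frac (a * (suc S * suc N) + b * c * suc N) (suc N * (suc S * suc N))
    ≡⟨ frac-cong (a * (suc S * suc N) + b * c * suc N) (N + S * suc N + N * suc (N + S * suc N)) e Q (begin
         (a * (suc S * suc N) + b * c * suc N) * suc Q  ≡⟨ regroup a (suc S) (suc N) b c (suc Q) ⟩
         (a * suc S + b * c) * suc Q * suc N            ≡⟨ cong (_* suc N) cross ⟩
         e * (suc S * suc N) * suc N                    ≡⟨ regroup′ e (suc S) (suc N) ⟩
         e * (suc N * (suc S * suc N))                  ∎) ⟩
  frac e (suc Q) ∎
  where
  open ≡-Reasoning
  regroup : ∀ a S N b c Q → (a * (S * N) + b * c * N) * Q ≡ (a * S + b * c) * Q * N
  regroup = solve-∀
  regroup′ : ∀ e S N → e * (S * N) * N ≡ e * (N * (S * N))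
  regroup′ = solve-∀

frac-recurrence : ∀ A A′ N T T′ Q Q′ S kd → N ≢ 0 → Q ≢ 0 →
                  A * Q ≡ N * T → A′ * Q′ ≡ N * T′ → Q ≡ suc S * Q′ →
                  frac A N ≡ frac (T + kd * T′) Q - frac kd (suc S) ℚ.* frac A′ N
frac-recurrence A A′ zero    T T′ Q       Q′ S kd N≢0 _   _  _   _  = contradiction refl N≢0
frac-recurrence A A′ (suc N) T T′ zero    Q′ S kd _   Q≢0 _  _   _  = contradiction refl Q≢0
frac-recurrence A A′ (suc N) T T′ (suc Q) Q′ S kd _   _   AQ A′Q′ Q≡ =
  trans (sym (//-rightDividesʳ (frac kd (suc S) ℚ.* frac A′ (suc N)) (frac A (suc N))))
        (cong (_- frac kd (suc S) ℚ.* frac A′ (suc N)) (frac-+-*-frac A kd A′ (T + kd * T′) N S Q (begin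
    (A * suc S + kd * A′) * suc Q                    ≡⟨ regroup A (suc S) kd A′ (suc Q) ⟩
    suc S * (A * suc Q) + kd * (A′ * suc Q)          ≡⟨ cong (λ z → suc S * (A * suc Q) + kd * (A′ * z)) Q≡ ⟩
    suc S * (A * suc Q) + kd * (A′ * (suc S * Q′))   ≡⟨ regroup′ (suc S) (A * suc Q) kd A′ Q′ ⟩
    suc S * (A * suc Q) + kd * suc S * (A′ * Q′)     ≡⟨ cong₂ (λ x y → suc S * x + kd * suc S * y) AQ A′Q′ ⟩
    suc S * (suc N * T) + kd * suc S * (suc N * T′)  ≡⟨ regroup″ (suc S) (suc N) T kd T′ ⟩
    (T + kd * T′) * (suc S * suc N)                  ∎)))
  where
  open ≡-Reasoning
  regroup : ∀ A S kd A′ Q → (A * S + kd * A′) * Q ≡ S * (A * Q) + kd * (A′ * Q)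
  regroup = solve-∀
  regroup′ : ∀ S X kd A′ Q′ → S * X + kd * (A′ * (S * Q′)) ≡ S * X + kd * S * (A′ * Q′)
  regroup′ = solve-∀
  regroup″ : ∀ S N T kd T′ → S * (N * T) + kd * S * (N * T′) ≡ (T + kd * T′) * (S * N)
  regroup″ = solve-∀

lemma3p3 : (n : ℕ) (d : Fin n → ℕ) → IsDegreeSeq d →
    (k : ℕ) → 2 ≤ k → k ≤ n → (v : Fin n) →
    probSixGt d v k ≡
    g d k - frac (k Data.Nat.* d v) (n ∸ k + 1) Data.Rational.* probSixGt d v (k ∸ 1)
lemma3p3 n d deg (suc k) (s≤s (s≤s _)) k<n v = begin
  probSixGt d v (suc k)
    ≡⟨ frac-recurrence _ _ _ (T (suc k)) (T k) (n P suc k) (n P k) (n ∸ suc k) (suc k * d v)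
         (length-𝔉≢0 d ∑d≡n) (P≢0 k<n) (sixLength>-ratio d ∑d≡n v (suc k) k<n)
         (sixLength>-ratio d ∑d≡n v k (<⇒≤ k<n)) (P-suc k<n) ⟩
  frac (T (suc k) + suc k * d v * T k) (n P suc k) - frac (suc k * d v) (suc (n ∸ suc k)) ℚ.* probSixGt d v k
    ≡⟨ cong₂ (λ x y → frac x (n P suc k) - frac (suc k * d v) y ℚ.* probSixGt d v k)
             (sym (!*incSum-without d v k)) (+-comm 1 (n ∸ suc k)) ⟩
  g d (suc k) - frac (suc k * d v) (n ∸ suc k + 1) ℚ.* probSixGt d v k ∎
  where
  open ≡-Reasoning
  ∑d≡n = trans (sym (sum-map-tabulate id d)) deg
  T = λ j → j ! * esym j (d without v)
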